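{- Let $m,n\geqslant 7$, $i_1,\dots,i_m\in[n]$ distinct and $j_1,\dots,j_m\in[n]$ distinct. Let $S_0$ be the set of vertices $P^{[2]}_\sigma$ of $\mathrm{QAP}_n$ for which $\sigma(i_r)\neq j_r$ for all $r\in[m]$, and let $G=(S_0,E)$ be the graph in which $\{P^{[2]}_{\sigma_1},P^{[2]}_{\sigma_2}\}\in E$ iff $\sigma_2$ is obtained from $\sigma_1$ by a transposition (i.e. by swapping the values $\sigma_1(x),\sigma_1(y)$ for some $x\neq y$). Then $G$ is connected.
   Context: $P_\sigma$ is the $n\times n$ permutation matrix of $\sigma\in S_n$ ($P_\sigma(i,j)=1$ iff $\sigma(i)=j$); $P^{[2]}_\sigma$ is the $n^2\times n^2$ matrix with rows/columns indexed by pairs $(ij)$ and $P^{[2]}_\sigma(ij,kl)=P_\sigma(i,j)P_\sigma(k,l)$; $\mathrm{QAP}_n=\mathrm{conv}\{P^{[2]}_\sigma:\sigma\in S_n\}$. -}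

module Defs where

open import Data.Nat using (ℕ)
open import Data.Fin using (Fin)
open import Data.Fin.Permutation using (Permutation′; _⟨$⟩ʳ_; transpose)
open import Data.Product using (Σ; ∃; ∃-syntax; _×_; _,_; proj₁)
open import Function.Definitions using (Injective)
open import Relation.Binary.PropositionalEquality using (_≡_; _≢_)
open import Relation.Binary.Construct.Closure.ReflexiveTransitive using (Star)

Avoids : ∀ {m n} → (Fin m → Fin n) → (Fin m → Fin n) → Permutation′ n → Set
Avoids {m} i j σ = (r : Fin m) → (σ ⟨$⟩ʳ i r) ≢ j r

-- The vertex set S₀, indexed by permutations (σ ↦ P^[2]_σ is injective).
S₀ : ∀ {m n} → (Fin m → Fin n) → (Fin m → Fin n) → Set
S₀ {n = n} i j = Σ (Permutation′ n) (Avoids i j)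

TranspAdj : ∀ {n} → Permutation′ n → Permutation′ n → Set
TranspAdj {n} σ τ =
  ∃[ x ] ∃[ y ] (x ≢ y × ((z : Fin n) → τ ⟨$⟩ʳ z ≡ σ ⟨$⟩ʳ (transpose x y ⟨$⟩ʳ z)))

Edge : ∀ {m n} (i j : Fin m → Fin n) → S₀ i j → S₀ i j → Set
Edge i j (σ , _) (τ , _) = TranspAdj σ τ

Connected : ∀ {m n} (i j : Fin m → Fin n) → Set
Connected {n = n} i j =
  (u v : S₀ i j) → ∃[ w ] (Star (Edge i j) u w ×
    ((z : Fin n) → proj₁ w ⟨$⟩ʳ z ≡ proj₁ v ⟨$⟩ʳ z))

module Submission where

-- Walk greedily towards the target τ. If σ x ≠ τ x, let y be the position where σ holds τ x;
-- swapping x and y fixes x and creates no new mismatch, unless σ x is forbidden at y. Since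
-- i and j are injective the forbidden pairs form a partial matching, so then z := τ⁻¹(σ x)
-- differs from x and y, and the values at x, y, z can be rotated (x ← σ y, y ← σ z, z ← σ x)
-- by two transpositions in one of two orders, or, when both orders are blocked, by four
-- transpositions through a fourth position w. Either way the set of mismatched positions
-- shrinks strictly, which bounds the length of the walk.

open import Data.Bool.Base using (true; false; not)
open import Data.Fin using (Fin; zero; _≟_; punchIn; punchOut)
open import Data.Fin.Permutation using (Permutation′; _⟨$⟩ʳ_; _⟨$⟩ˡ_; _∘ₚ_; inverseʳ; transpose)
open import Data.Fin.Properties
  using (any?; all?; ¬∀⟶∃¬; punchIn-injective; punchInᵢ≢i; punchIn-punchOut)
open import Data.Fin.Subset using (Subset; _∈_; _∉_; _⊆_; _⊂_)
open import Data.Fin.Subset.Induction using (Acc; acc; ⊂-wellFounded)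
open import Data.Nat using (ℕ; suc; _+_; _≤_; s≤s)
open import Data.Product using (∃-syntax; _×_; _,_; proj₁)
open import Data.Sum using (_⊎_; inj₁; inj₂)
open import Data.Vec using (tabulate; lookup)
open import Data.Vec.Properties using (lookup∘tabulate; []=⇒lookup; lookup⇒[]=)
open import Function.Base using (_∘_)
open import Function.Bundles using (Injection)
open import Function.Definitions using (Injective)
open import Function.Properties.Inverse using (↔⇒↣)
open import Relation.Binary.Construct.Closure.ReflexiveTransitive using (Star; ε; _◅◅_)
open import Relation.Binary.Construct.Closure.ReflexiveTransitive.Properties
  using (module StarReasoning)
open import Relation.Binary.PropositionalEquality
  using (_≡_; _≢_; refl; sym; trans; cong; subst₂; module ≡-Reasoning)
open import Relation.Nullary using (Dec; yes; no; does; ¬_; contradiction)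
open import Relation.Nullary.Decidable using (_×-dec_; dec-true; dec-false)

open import Defs

private variable n : ℕ

transpose-matchˡ : (a b : Fin n) → transpose a b ⟨$⟩ʳ a ≡ b
transpose-matchˡ a b rewrite dec-true (a ≟ a) refl = refl

transpose-matchʳ : (a b : Fin n) → transpose a b ⟨$⟩ʳ b ≡ a
transpose-matchʳ a b with b ≟ a
... | yes refl = refl
... | no _ rewrite dec-true (b ≟ b) refl = refl

transpose-mod : {a b k : Fin n} → k ≢ a → k ≢ b → transpose a b ⟨$⟩ʳ k ≡ k
transpose-mod {a = a} {b} {k} k≢a k≢b rewrite dec-false (k ≟ a) k≢a | dec-false (k ≟ b) k≢b = refl

permute-injective : (σ : Permutation′ n) → Injective _≡_ _≡_ (σ ⟨$⟩ʳ_)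
permute-injective σ = Injection.injective (↔⇒↣ σ)

disagreement : Permutation′ n → Permutation′ n → Subset n
disagreement σ τ = tabulate λ p → not (does (σ ⟨$⟩ʳ p ≟ τ ⟨$⟩ʳ p))

∈-disagreement : (σ τ : Permutation′ n) {p : Fin n} → σ ⟨$⟩ʳ p ≢ τ ⟨$⟩ʳ p → p ∈ disagreement σ τ
∈-disagreement σ τ {p} σp≢τp =
  lookup⇒[]= p _ (trans (lookup∘tabulate _ p) (cong not (dec-false (σ ⟨$⟩ʳ p ≟ τ ⟨$⟩ʳ p) σp≢τp)))

∉-disagreement : (σ τ : Permutation′ n) {p : Fin n} → σ ⟨$⟩ʳ p ≡ τ ⟨$⟩ʳ p → p ∉ disagreement σ τ
∉-disagreement σ τ {p} σp≡τp p∈ = contradiction false≡true λ ()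
  where
  open ≡-Reasoning
  false≡true : false ≡ true
  false≡true = begin
    false                                  ≡⟨ cong not (dec-true (σ ⟨$⟩ʳ p ≟ τ ⟨$⟩ʳ p) σp≡τp) ⟨
    not (does (σ ⟨$⟩ʳ p ≟ τ ⟨$⟩ʳ p))        ≡⟨ lookup∘tabulate _ p ⟨
    lookup (disagreement σ τ) p            ≡⟨ []=⇒lookup p∈ ⟩
    true                                   ∎

disagreement-⊂ : (σ ρ τ : Permutation′ n) {x : Fin n} →
  (∀ p → ρ ⟨$⟩ʳ p ≡ σ ⟨$⟩ʳ p ⊎ σ ⟨$⟩ʳ p ≢ τ ⟨$⟩ʳ p) →
  σ ⟨$⟩ʳ x ≢ τ ⟨$⟩ʳ x → ρ ⟨$⟩ʳ x ≡ τ ⟨$⟩ʳ x → disagreement ρ τ ⊂ disagreement σ τ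
disagreement-⊂ σ ρ τ {x} unchanged σx≢τx ρx≡τx =
  ⊆ , x , ∈-disagreement σ τ σx≢τx , ∉-disagreement ρ τ ρx≡τx
  where
  ⊆ : disagreement ρ τ ⊆ disagreement σ τ
  ⊆ {p} p∈ with unchanged p
  ... | inj₁ ρp≡σp = ∈-disagreement σ τ λ σp≡τp → ∉-disagreement ρ τ (trans ρp≡σp σp≡τp) p∈
  ... | inj₂ σp≢τp = ∈-disagreement σ τ σp≢τp

swapAt : Permutation′ n → Fin n → Fin n → Permutation′ n
swapAt σ a b = transpose a b ∘ₚ σ

swapAt-matchˡ : (σ : Permutation′ n) (a b : Fin n) → swapAt σ a b ⟨$⟩ʳ a ≡ σ ⟨$⟩ʳ b
swapAt-matchˡ σ a b = cong (σ ⟨$⟩ʳ_) (transpose-matchˡ a b)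

swapAt-matchʳ : (σ : Permutation′ n) (a b : Fin n) → swapAt σ a b ⟨$⟩ʳ b ≡ σ ⟨$⟩ʳ a
swapAt-matchʳ σ a b = cong (σ ⟨$⟩ʳ_) (transpose-matchʳ a b)

swapAt-mod : (σ : Permutation′ n) {a b k : Fin n} → k ≢ a → k ≢ b → swapAt σ a b ⟨$⟩ʳ k ≡ σ ⟨$⟩ʳ k
swapAt-mod σ k≢a k≢b = cong (σ ⟨$⟩ʳ_) (transpose-mod k≢a k≢b)

swapAt-adjacent : (σ : Permutation′ n) {a b : Fin n} → a ≢ b → TranspAdj σ (swapAt σ a b)
swapAt-adjacent σ {a} {b} a≢b = a , b , a≢b , λ _ → refl

∃-≢₃ : ∀ {k} {x y z : Fin (4 + k)} → x ≢ y → x ≢ z → y ≢ z → ∃[ w ] w ≢ x × w ≢ y × w ≢ z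
∃-≢₃ {k} {x} {y} {z} x≢y x≢z y≢z = w , w≢x , w≢y , w≢z
  where
  open ≡-Reasoning
  y′ z′ : Fin (3 + k)
  y′ = punchOut x≢y
  z′ = punchOut x≢z
  y′≢z′ : y′ ≢ z′
  y′≢z′ y′≡z′ = y≢z (begin
    y                  ≡⟨ punchIn-punchOut x≢y ⟨
    punchIn x y′       ≡⟨ cong (punchIn x) y′≡z′ ⟩
    punchIn x z′       ≡⟨ punchIn-punchOut x≢z ⟩
    z                  ∎)
  z″ : Fin (2 + k)
  z″ = punchOut y′≢z′
  w : Fin (4 + k)
  w = punchIn x (punchIn y′ (punchIn z″ zero))
  w≢x : w ≢ x
  w≢x = punchInᵢ≢i x _
  w≢y : w ≢ y
  w≢y w≡y = punchInᵢ≢i y′ _ (punchIn-injective x _ _ (trans w≡y (sym (punchIn-punchOut x≢y))))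
  w≢z : w ≢ z
  w≢z w≡z = punchInᵢ≢i z″ zero (punchIn-injective y′ _ _ (begin
    punchIn y′ (punchIn z″ zero)  ≡⟨ punchIn-injective x _ _ (trans w≡z (sym (punchIn-punchOut x≢z))) ⟩
    z′                            ≡⟨ punchIn-punchOut y′≢z′ ⟨
    punchIn y′ z″                 ∎))

module ForbiddenPositions {m n} (i j : Fin m → Fin n) where

  Forbidden : Fin n → Fin n → Set
  Forbidden p v = ∃[ r ] i r ≡ p × j r ≡ v

  forbidden? : (p v : Fin n) → Dec (Forbidden p v)
  forbidden? p v = any? λ r → (i r ≟ p) ×-dec (j r ≟ v)

  allowed-≡ : {p v v′ : Fin n} → v ≡ v′ → ¬ Forbidden p v′ → ¬ Forbidden p v
  allowed-≡ refl allowed = allowed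

  forbidden-value-unique : Injective _≡_ _≡_ i → {p v v′ : Fin n} →
                           Forbidden p v → Forbidden p v′ → v ≡ v′
  forbidden-value-unique i-inj (r , refl , refl) (r′ , ir′≡ir , refl) = cong j (i-inj (sym ir′≡ir))

  forbidden-position-unique : Injective _≡_ _≡_ j → {p p′ v : Fin n} →
                              Forbidden p v → Forbidden p′ v → p ≡ p′
  forbidden-position-unique j-inj (r , refl , refl) (r′ , refl , jr′≡jr) = cong i (j-inj (sym jr′≡jr))

  avoids⇒allowed : (σ : Permutation′ n) → Avoids i j σ → ∀ p → ¬ Forbidden p (σ ⟨$⟩ʳ p)
  avoids⇒allowed σ σ-avoids p (r , refl , jr≡σp) = σ-avoids r (sym jr≡σp)

  allowed⇒avoids : (σ : Permutation′ n) → (∀ p → ¬ Forbidden p (σ ⟨$⟩ʳ p)) → Avoids i j σ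
  allowed⇒avoids σ allowed r σir≡jr = allowed (i r) (r , refl , sym σir≡jr)

  swapAt-avoids : (σ : Permutation′ n) (a b : Fin n) → Avoids i j σ →
                  ¬ Forbidden a (σ ⟨$⟩ʳ b) → ¬ Forbidden b (σ ⟨$⟩ʳ a) → Avoids i j (swapAt σ a b)
  swapAt-avoids σ a b σ-avoids a-allowed b-allowed = allowed⇒avoids (swapAt σ a b) allowed
    where
    allowed : ∀ p → ¬ Forbidden p (swapAt σ a b ⟨$⟩ʳ p)
    allowed p = by-position (p ≟ a) (p ≟ b)
      where
      by-position : Dec (p ≡ a) → Dec (p ≡ b) → ¬ Forbidden p (swapAt σ a b ⟨$⟩ʳ p)
      by-position (yes refl) _          = allowed-≡ (swapAt-matchˡ σ a b) a-allowed
      by-position (no _)     (yes refl) = allowed-≡ (swapAt-matchʳ σ a b) b-allowed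
      by-position (no p≢a)   (no p≢b)   = allowed-≡ (swapAt-mod σ p≢a p≢b) (avoids⇒allowed σ σ-avoids p)

module Walk {k m} {i j : Fin m → Fin (4 + k)}
            (i-inj : Injective _≡_ _≡_ i) (j-inj : Injective _≡_ _≡_ j)
            (τ : Permutation′ (4 + k)) (τ-avoids : Avoids i j τ) where

  open ForbiddenPositions i j
  open StarReasoning (Edge i j)

  Progress : S₀ i j → Set
  Progress u = ∃[ v ] Star (Edge i j) u v × disagreement (proj₁ v) τ ⊂ disagreement (proj₁ u) τ

  swapVertex : (u : S₀ i j) (a b : Fin (4 + k)) →
               ¬ Forbidden a (proj₁ u ⟨$⟩ʳ b) → ¬ Forbidden b (proj₁ u ⟨$⟩ʳ a) → S₀ i j
  swapVertex (σ , σ-avoids) a b a-allowed b-allowed =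
    swapAt σ a b , swapAt-avoids σ a b σ-avoids a-allowed b-allowed

  allowed-elsewhere : (σ : Permutation′ (4 + k)) {p q q′ : Fin (4 + k)} →
                      Forbidden p (σ ⟨$⟩ʳ q) → q′ ≢ q → ¬ Forbidden p (σ ⟨$⟩ʳ q′)
  allowed-elsewhere σ forbidden q′≢q forbidden′ =
    q′≢q (permute-injective σ (forbidden-value-unique i-inj forbidden′ forbidden))

  module AtMismatch (σ : Permutation′ (4 + k)) (σ-avoids : Avoids i j σ)
                    {x : Fin (4 + k)} (σx≢τx : σ ⟨$⟩ʳ x ≢ τ ⟨$⟩ʳ x) where

    u₀ : S₀ i j
    u₀ = σ , σ-avoids

    y : Fin (4 + k)
    y = σ ⟨$⟩ˡ (τ ⟨$⟩ʳ x)

    σy≡τx : σ ⟨$⟩ʳ y ≡ τ ⟨$⟩ʳ x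
    σy≡τx = inverseʳ σ

    x≢y : x ≢ y
    x≢y x≡y = σx≢τx (trans (cong (σ ⟨$⟩ʳ_) x≡y) σy≡τx)

    σy≢τy : σ ⟨$⟩ʳ y ≢ τ ⟨$⟩ʳ y
    σy≢τy σy≡τy = x≢y (permute-injective τ (trans (sym σy≡τx) σy≡τy))

    σy-allowed-at-x : ¬ Forbidden x (σ ⟨$⟩ʳ y)
    σy-allowed-at-x = allowed-≡ σy≡τx (avoids⇒allowed τ τ-avoids x)

    progress-via : (z : Fin (4 + k)) → σ ⟨$⟩ʳ z ≢ τ ⟨$⟩ʳ z → (v : S₀ i j) → Star (Edge i j) u₀ v →
                   proj₁ v ⟨$⟩ʳ x ≡ σ ⟨$⟩ʳ y →
                   (∀ p → p ≢ x → p ≢ y → p ≢ z → proj₁ v ⟨$⟩ʳ p ≡ σ ⟨$⟩ʳ p) → Progress u₀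
    progress-via z σz≢τz v u₀⇝v vx≡σy unchanged =
      v , u₀⇝v , disagreement-⊂ σ (proj₁ v) τ unchanged-or-mismatched σx≢τx (trans vx≡σy σy≡τx)
      where
      unchanged-or-mismatched : ∀ p → proj₁ v ⟨$⟩ʳ p ≡ σ ⟨$⟩ʳ p ⊎ σ ⟨$⟩ʳ p ≢ τ ⟨$⟩ʳ p
      unchanged-or-mismatched p with p ≟ x | p ≟ y | p ≟ z
      ... | yes refl | _        | _        = inj₂ σx≢τx
      ... | no _     | yes refl | _        = inj₂ σy≢τy
      ... | no _     | no _     | yes refl = inj₂ σz≢τz
      ... | no p≢x   | no p≢y   | no p≢z   = inj₁ (unchanged p p≢x p≢y p≢z)

    swap-x-y : ¬ Forbidden y (σ ⟨$⟩ʳ x) → Progress u₀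
    swap-x-y σx-allowed-at-y = progress-via y σy≢τy u₁ (begin u₀ ⟶⟨ swapAt-adjacent σ x≢y ⟩ u₁ ∎)
      (swapAt-matchˡ σ x y) (λ p p≢x p≢y _ → swapAt-mod σ p≢x p≢y)
      where
      u₁ : S₀ i j
      u₁ = swapVertex u₀ x y σy-allowed-at-x σx-allowed-at-y

    module Blocked (σx-forbidden-at-y : Forbidden y (σ ⟨$⟩ʳ x)) where

      z : Fin (4 + k)
      z = τ ⟨$⟩ˡ (σ ⟨$⟩ʳ x)

      τz≡σx : τ ⟨$⟩ʳ z ≡ σ ⟨$⟩ʳ x
      τz≡σx = inverseʳ τ

      σx-allowed-elsewhere : {p : Fin (4 + k)} → p ≢ y → ¬ Forbidden p (σ ⟨$⟩ʳ x)
      σx-allowed-elsewhere p≢y σx-forbidden-at-p =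
        p≢y (forbidden-position-unique j-inj σx-forbidden-at-p σx-forbidden-at-y)

      allowed-at-y : {q : Fin (4 + k)} → q ≢ x → ¬ Forbidden y (σ ⟨$⟩ʳ q)
      allowed-at-y = allowed-elsewhere σ σx-forbidden-at-y

      z≢x : z ≢ x
      z≢x z≡x = σx≢τx (trans (sym τz≡σx) (cong (τ ⟨$⟩ʳ_) z≡x))

      z≢y : z ≢ y
      z≢y z≡y = avoids⇒allowed τ τ-avoids z (subst₂ Forbidden (sym z≡y) (sym τz≡σx) σx-forbidden-at-y)

      σz≢τz : σ ⟨$⟩ʳ z ≢ τ ⟨$⟩ʳ z
      σz≢τz σz≡τz = z≢x (permute-injective σ (trans σz≡τz τz≡σx))

      rotate-via-xz : ¬ Forbidden x (σ ⟨$⟩ʳ z) → Progress u₀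
      rotate-via-xz σz-allowed-at-x = progress-via z σz≢τz u₂
        (begin u₀ ⟶⟨ swapAt-adjacent σ (z≢x ∘ sym) ⟩ u₁ ⟶⟨ swapAt-adjacent σ₁ x≢y ⟩ u₂ ∎)
        (trans (swapAt-matchˡ σ₁ x y) σ₁y≡σy)
        (λ p p≢x p≢y p≢z → trans (swapAt-mod σ₁ p≢x p≢y) (swapAt-mod σ p≢x p≢z))
        where
        σ₁ : Permutation′ (4 + k)
        σ₁ = swapAt σ x z
        σ₁y≡σy : σ₁ ⟨$⟩ʳ y ≡ σ ⟨$⟩ʳ y
        σ₁y≡σy = swapAt-mod σ (x≢y ∘ sym) (z≢y ∘ sym)
        u₁ : S₀ i j
        u₁ = swapVertex u₀ x z σz-allowed-at-x (σx-allowed-elsewhere z≢y)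
        u₂ : S₀ i j
        u₂ = swapVertex u₁ x y (allowed-≡ σ₁y≡σy σy-allowed-at-x)
                               (allowed-≡ (swapAt-matchˡ σ x z) (allowed-at-y z≢x))

      rotate-via-yz : ¬ Forbidden z (σ ⟨$⟩ʳ y) → Progress u₀
      rotate-via-yz σy-allowed-at-z = progress-via z σz≢τz u₂
        (begin u₀ ⟶⟨ swapAt-adjacent σ (z≢y ∘ sym) ⟩ u₁ ⟶⟨ swapAt-adjacent σ₁ (z≢x ∘ sym) ⟩ u₂ ∎)
        (trans (swapAt-matchˡ σ₁ x z) (swapAt-matchʳ σ y z))
        (λ p p≢x p≢y p≢z → trans (swapAt-mod σ₁ p≢x p≢z) (swapAt-mod σ p≢y p≢z))
        where
        σ₁ : Permutation′ (4 + k)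
        σ₁ = swapAt σ y z
        u₁ : S₀ i j
        u₁ = swapVertex u₀ y z (allowed-at-y z≢x) σy-allowed-at-z
        u₂ : S₀ i j
        u₂ = swapVertex u₁ x z (allowed-≡ (swapAt-matchʳ σ y z) σy-allowed-at-x)
                               (allowed-≡ (swapAt-mod σ x≢y (z≢x ∘ sym)) (σx-allowed-elsewhere z≢y))

      rotate-via-w : Forbidden x (σ ⟨$⟩ʳ z) → Forbidden z (σ ⟨$⟩ʳ y) → Progress u₀
      rotate-via-w σz-forbidden-at-x σy-forbidden-at-z with ∃-≢₃ x≢y (z≢x ∘ sym) (z≢y ∘ sym)
      ... | w , w≢x , w≢y , w≢z = progress-via z σz≢τz u₄
        (begin
          u₀ ⟶⟨ swapAt-adjacent σ  (w≢x ∘ sym) ⟩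
          u₁ ⟶⟨ swapAt-adjacent σ₁ x≢y ⟩
          u₂ ⟶⟨ swapAt-adjacent σ₂ (z≢y ∘ sym) ⟩
          u₃ ⟶⟨ swapAt-adjacent σ₃ (w≢z ∘ sym) ⟩
          u₄ ∎)
        σ₄x≡σy σ₄-unchanged
        where
        σ₁ : Permutation′ (4 + k)
        σ₁ = swapAt σ x w
        σ₂ : Permutation′ (4 + k)
        σ₂ = swapAt σ₁ x y
        σ₃ : Permutation′ (4 + k)
        σ₃ = swapAt σ₂ y z
        σ₄ : Permutation′ (4 + k)
        σ₄ = swapAt σ₃ z w

        σ₁y≡σy : σ₁ ⟨$⟩ʳ y ≡ σ ⟨$⟩ʳ y
        σ₁y≡σy = swapAt-mod σ (x≢y ∘ sym) (w≢y ∘ sym)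
        σ₂y≡σw : σ₂ ⟨$⟩ʳ y ≡ σ ⟨$⟩ʳ w
        σ₂y≡σw = trans (swapAt-matchʳ σ₁ x y) (swapAt-matchˡ σ x w)
        σ₂z≡σz : σ₂ ⟨$⟩ʳ z ≡ σ ⟨$⟩ʳ z
        σ₂z≡σz = trans (swapAt-mod σ₁ z≢x z≢y) (swapAt-mod σ z≢x (w≢z ∘ sym))
        σ₃w≡σx : σ₃ ⟨$⟩ʳ w ≡ σ ⟨$⟩ʳ x
        σ₃w≡σx = trans (swapAt-mod σ₂ w≢y w≢z) (trans (swapAt-mod σ₁ w≢x w≢y) (swapAt-matchʳ σ x w))
        σ₃z≡σw : σ₃ ⟨$⟩ʳ z ≡ σ ⟨$⟩ʳ w
        σ₃z≡σw = trans (swapAt-matchʳ σ₂ y z) σ₂y≡σw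

        u₁ : S₀ i j
        u₁ = swapVertex u₀ x w (allowed-elsewhere σ σz-forbidden-at-x w≢z) (σx-allowed-elsewhere w≢y)
        u₂ : S₀ i j
        u₂ = swapVertex u₁ x y (allowed-≡ σ₁y≡σy σy-allowed-at-x)
                               (allowed-≡ (swapAt-matchˡ σ x w) (allowed-at-y w≢x))
        u₃ : S₀ i j
        u₃ = swapVertex u₂ y z (allowed-≡ σ₂z≡σz (allowed-at-y z≢x))
                               (allowed-≡ σ₂y≡σw (allowed-elsewhere σ σy-forbidden-at-z w≢y))
        u₄ : S₀ i j
        u₄ = swapVertex u₃ z w (allowed-≡ σ₃w≡σx (σx-allowed-elsewhere z≢y))
                               (allowed-≡ σ₃z≡σw (avoids⇒allowed σ σ-avoids w))

        σ₄x≡σy : σ₄ ⟨$⟩ʳ x ≡ σ ⟨$⟩ʳ y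
        σ₄x≡σy = trans (swapAt-mod σ₃ (z≢x ∘ sym) (w≢x ∘ sym))
                 (trans (swapAt-mod σ₂ x≢y (z≢x ∘ sym))
                 (trans (swapAt-matchˡ σ₁ x y) σ₁y≡σy))

        σ₄-unchanged : ∀ p → p ≢ x → p ≢ y → p ≢ z → σ₄ ⟨$⟩ʳ p ≡ σ ⟨$⟩ʳ p
        σ₄-unchanged p p≢x p≢y p≢z with p ≟ w
        ... | yes refl = trans (swapAt-matchʳ σ₃ z p) σ₃z≡σw
        ... | no p≢w   = trans (swapAt-mod σ₃ p≢z p≢w) (trans (swapAt-mod σ₂ p≢y p≢z)
                         (trans (swapAt-mod σ₁ p≢x p≢y) (swapAt-mod σ p≢x p≢w)))

      progress : Progress u₀
      progress with forbidden? x (σ ⟨$⟩ʳ z) | forbidden? z (σ ⟨$⟩ʳ y)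
      ... | no σz-allowed-at-x | _                  = rotate-via-xz σz-allowed-at-x
      ... | yes _              | no σy-allowed-at-z = rotate-via-yz σy-allowed-at-z
      ... | yes σz-forbidden   | yes σy-forbidden   = rotate-via-w σz-forbidden σy-forbidden

    progress : Progress u₀
    progress with forbidden? y (σ ⟨$⟩ʳ x)
    ... | no σx-allowed-at-y    = swap-x-y σx-allowed-at-y
    ... | yes σx-forbidden-at-y = Blocked.progress σx-forbidden-at-y

  walk : (u : S₀ i j) → Acc _⊂_ (disagreement (proj₁ u) τ) →
         ∃[ v ] Star (Edge i j) u v × (∀ p → proj₁ v ⟨$⟩ʳ p ≡ τ ⟨$⟩ʳ p)
  walk u@(σ , σ-avoids) (acc smaller) with all? (λ p → σ ⟨$⟩ʳ p ≟ τ ⟨$⟩ʳ p)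
  ... | yes σ≗τ = u , ε , σ≗τ
  ... | no σ≉τ with ¬∀⟶∃¬ _ _ (λ p → σ ⟨$⟩ʳ p ≟ τ ⟨$⟩ʳ p) σ≉τ
  ...   | x , σx≢τx with AtMismatch.progress σ σ-avoids σx≢τx
  ...     | v , u⇝v , shrinks with walk v (smaller shrinks)
  ...       | w , v⇝w , w≗τ = w , u⇝v ◅◅ v⇝w , w≗τ

lemma5 : (m n : ℕ) → 7 ≤ m → 7 ≤ n →
         (i j : Fin m → Fin n) → Injective _≡_ _≡_ i → Injective _≡_ _≡_ j →
         Connected i j
lemma5 m (suc (suc (suc (suc k)))) _ (s≤s (s≤s (s≤s (s≤s _)))) i j i-inj j-inj u (τ , τ-avoids) =
  walk u (⊂-wellFounded _)
  where open Walk i-inj j-inj τ τ-avoids
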